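{- Let $n,m\ge1$ and consider the $n\times m$ grid communication graph with a direction assignment $g$ on its circles such that adjacent circles have opposite directions. Then there are exactly $\gcd(n,m)$ rings, all of the same length, and for each of the four walls (top, bottom, left, right) all rings have the same number of hitting points on that wall.
   Context: Circles are pairwise disjoint unit circles in the plane. The $n\times m$ grid communication graph consists of $nm$ circles arranged in $n$ rows and $m$ columns, circles of a row horizontally aligned and circles of a column vertically aligned (centers on a square lattice), where circle $(i,j)$ (row $i$, column $j$) is adjacent exactly to the existing circles among $(i\pm1,j)$ and $(i,j\pm1)$. For adjacent circles $C_i,C_j$, the link point of $C_i$ with respect to $C_j$ is the point of $C_i$ closest to $C_j$. A direction assignment gives each circle a direction ($1$ = counterclockwise, $-1$ = clockwise). A ring is a closed curve traced by a point that moves along the circles, on each circle in the direction assigned to that circle, and that, whenever it reaches a link point of its current circle $C_i$ with respect to an adjacent circle $C_j$, passes to $C_j$ at the corresponding link point of $C_j$ and continues there in the direction of $C_j$ (this is the motion of a robot that never meets any other robot). The circles decompose into pairwise disjoint rings (which may intersect only at link points). The length of a ring is the total length of the circle arcs forming it. A ring hits the top wall at a circle of row $1$ if it passes through the topmost point of that circle; hitting the bottom wall (bottommost points of circles of row $n$), the left wall (leftmost points of circles of column $1$) and the right wall (rightmost points of circles of column $m$) are defined analogously; each such point is a hitting point. -}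

module Defs where

open import Data.Nat using (ℕ; zero; suc; _+_; _*_)
open import Data.Nat.Properties using () renaming (_≟_ to _≟ℕ_)
open import Data.Fin using (Fin; zero; suc; toℕ; inject₁)
open import Data.Fin.Properties using () renaming (_≟_ to _≟F_)
open import Data.Maybe using (Maybe; just; nothing)
import Data.Maybe as Maybe
open import Data.Product using (_×_; _,_; proj₁; proj₂; ∃-syntax)
open import Relation.Binary.PropositionalEquality using (_≡_)
open import Relation.Nullary using (Dec; yes; no)

data Dir : Set where
  ccw cw : Dir

-- A circle of the n × m grid: (row, column); row 0 is the top row,
-- column 0 is the left column.
Circle : ℕ → ℕ → Set
Circle n m = Fin n × Fin m

-- The four cardinal points of a circle (these are the only possible link
-- points and hitting points):  0 = rightmost (E), 1 = topmost (N),
-- 2 = leftmost (W), 3 = bottommost (S), in counterclockwise order.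
-- A circle is cut by them into four quarter arcs; quarter arc q is the arc
-- from point q to point q+1 (mod 4) counterclockwise.
Point : Set
Point = Fin 4

east north west south : Point
east  = zero
north = suc zero
west  = suc (suc zero)
south = suc (suc (suc zero))

next4 : Fin 4 → Fin 4
next4 zero = suc zero
next4 (suc zero) = suc (suc zero)
next4 (suc (suc zero)) = suc (suc (suc zero))
next4 (suc (suc (suc zero))) = zero

prev4 : Fin 4 → Fin 4
prev4 zero = suc (suc (suc zero))
prev4 (suc zero) = zero
prev4 (suc (suc zero)) = suc zero
prev4 (suc (suc (suc zero))) = suc (suc zero)

opposite : Point → Point
opposite p = next4 (next4 p)

up : ∀ {k} → Fin k → Maybe (Fin k)
up zero = nothing
up (suc i) = just (inject₁ i)

down : ∀ {k} → Fin k → Maybe (Fin k)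
down {suc zero} zero = nothing
down {suc (suc k)} zero = just (suc zero)
down {suc (suc k)} (suc i) = Maybe.map suc (down i)

neighbour : ∀ {n m} → Circle n m → Point → Maybe (Circle n m)
neighbour (i , j) zero = Maybe.map (λ j' → (i , j')) (down j)
neighbour (i , j) (suc zero) = Maybe.map (λ i' → (i' , j)) (up i)
neighbour (i , j) (suc (suc zero)) = Maybe.map (λ j' → (i , j')) (up j)
neighbour (i , j) (suc (suc (suc zero))) = Maybe.map (λ i' → (i' , j)) (down i)

Adjacent : ∀ {n m} → Circle n m → Circle n m → Set
Adjacent c c' = ∃[ p ] neighbour c p ≡ just c'

DirAssignment : ℕ → ℕ → Set
DirAssignment n m = Circle n m → Dir

-- A state of the moving point: a quarter arc of a circle, traversed in the
-- direction of that circle.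
State : ℕ → ℕ → Set
State n m = Circle n m × Fin 4

arcEnd : Dir → Fin 4 → Point
arcEnd ccw q = next4 q
arcEnd cw q = q

arcFrom : Dir → Point → Fin 4
arcFrom ccw p = p
arcFrom cw p = prev4 p

arcInto : Dir → Point → Fin 4
arcInto ccw p = prev4 p
arcInto cw p = p

-- The motion: after traversing a quarter arc, at its end point p either
-- pass to the adjacent circle in direction p (arriving at its link point,
-- the opposite cardinal point) or continue on the same circle.
step : ∀ {n m} → DirAssignment n m → State n m → State n m
step g (c , q) with neighbour c (arcEnd (g c) q)
... | just c' = (c' , arcFrom (g c') (opposite (arcEnd (g c) q)))
... | nothing = (c , arcFrom (g c) (arcEnd (g c) q))

iter : ∀ {A : Set} → ℕ → (A → A) → A → A
iter zero f x = x
iter (suc k) f x = f (iter k f x)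

SameRing : ∀ {n m} → DirAssignment n m → State n m → State n m → Set
SameRing g s t = ∃[ k ] iter k (step g) s ≡ t

sumFin : ∀ k → (Fin k → ℕ) → ℕ
sumFin zero f = 0
sumFin (suc k) f = f zero + sumFin k (λ i → f (suc i))

ind : ∀ {P : Set} → Dec P → ℕ
ind (yes _) = 1
ind (no _) = 0

sumCircles : ∀ n m → (Circle n m → ℕ) → ℕ
sumCircles n m f = sumFin n (λ i → sumFin m (λ j → f (i , j)))

-- Given a ring labelling ρ, the length of ring r measured in quarter arcs
-- (the actual length is this number times π/2, circles being unit circles).
ringLength : ∀ {n m k} → (State n m → Fin k) → Fin k → ℕ
ringLength {n} {m} ρ r =
  sumCircles n m (λ c → sumFin 4 (λ q → ind (ρ (c , q) ≟F r)))

data Wall : Set where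
  top bottom left right : Wall

wallPoint : Wall → Point
wallPoint top = north
wallPoint bottom = south
wallPoint left = west
wallPoint right = east

onWall : ∀ {n m} → Wall → Circle n m → Set
onWall top (i , j) = toℕ i ≡ 0
onWall {n} bottom (i , j) = suc (toℕ i) ≡ n
onWall left (i , j) = toℕ j ≡ 0
onWall {m = m} right (i , j) = suc (toℕ j) ≡ m

onWall? : ∀ {n m} → (w : Wall) → (c : Circle n m) → Dec (onWall w c)
onWall? top (i , j) = toℕ i ≟ℕ 0
onWall? {n} bottom (i , j) = suc (toℕ i) ≟ℕ n
onWall? left (i , j) = toℕ j ≟ℕ 0
onWall? {m = m} right (i , j) = suc (toℕ j) ≟ℕ m

-- Number of hitting points of ring r on wall w: the number of circles c on
-- wall w whose wall point lies on ring r (i.e. ring r contains the quarter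
-- arc of c arriving at that point).
wallHits : ∀ {n m k} → DirAssignment n m → (State n m → Fin k) → Wall → Fin k → ℕ
wallHits {n} {m} g ρ w r =
  sumCircles n m (λ c →
    ind (onWall? w c) * ind (ρ (c , arcInto (g c) (wallPoint w)) ≟F r))

-- Each quarter arc projects to two tracks: the horizontal and the vertical
-- motion of the point, each bouncing along a row or a column.  Unfolding the
-- reflections they run around cycles of lengths 4 m and 4 n, so the motion is
-- the translation by (1, −1) on ℤ/4m × ℤ/4n in the coordinates X (horizontal
-- position) and Ȳ (position of the reflected vertical track), restricted to
-- the image of the arcs.  As adjacent circles have opposite directions, the
-- colouring "direction xor row parity xor column parity" is constant, and it
-- fixes X + Ȳ modulo 4; hence the arcs are exactly a quarter of the torus, and
-- X + Ȳ is invariant modulo gcd (4 m) (4 n) = 4 gcd n m.  By the Chinese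
-- remainder theorem, two arcs lie on one ring iff their levels (X + Ȳ) / 4
-- agree modulo gcd n m.  Moving the horizontal track two cells on is a
-- bijection of the arcs that raises the level by one and keeps the vertical
-- track, so all rings have the same length and the same hits on the top and
-- bottom walls; the vertical shift does the same for the left and right walls.

module Submission where

open import Defs
import Algebra.Properties.CommutativeMonoid.Sum as CommutativeMonoidSum
open import Data.Bool using (Bool; true; false; not; _xor_; _∧_)
open import Data.Bool.Properties using (not-injective; not-distribˡ-xor; not-distribʳ-xor)
open import Data.Empty using (⊥; ⊥-elim)
open import Data.Fin using (Fin; zero; suc; toℕ; inject₁; _↑ˡ_; _↑ʳ_; combine; remQuot)
  renaming (opposite to mirror)
open import Data.Fin.Induction using (<-weakInduction)
open import Data.Fin.Permutation using (permutation)
open import Data.Fin.Properties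
  using (toℕ-injective; toℕ<n; toℕ-inject₁; toℕ-fromℕ<; remQuot-combine; combine-remQuot)
  renaming (_≟_ to _≟ᶠ_; opposite-prop to mirror-prop; opposite-involutive to mirror-involutive)
open import Data.Maybe using (just; nothing)
import Data.Maybe as Maybe
open import Data.Nat
  using (ℕ; zero; suc; _+_; _*_; _∸_; _<_; _≤_; s≤s; z≤n; z<s; NonZero; >-nonZero; ≢-nonZero)
open import Data.Nat.Properties
open import Data.Nat.DivMod
  using (_%_; _/_; _mod_; m≡m%n+[m/n]*n; m%n<n; [m+kn]%n≡m%n; m<n⇒m%n≡m)
open import Data.Nat.Divisibility using (_∣_; divides; *-monoʳ-∣)
open import Data.Nat.GCD
  using (gcd; GCD; gcd[m,n]∣m; gcd[m,n]∣n; gcd[m,n]≢0; gcd-comm; gcd-GCD; c*gcd[m,n]≡gcd[cm,cn]; module Bézout)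
open import Data.Nat.Tactic.RingSolver using (solve-∀)
open import Data.Product using (_×_; _,_; proj₁; proj₂; ∃-syntax; uncurry)
open import Data.Sum using (_⊎_; inj₁; inj₂)
open import Function.Base using (_∘_)
open import Function.Bundles using (_⇔_; mk⇔)
open import Relation.Binary.Bundles using (Setoid)
open import Relation.Binary.Structures using (IsEquivalence)
import Relation.Binary.Reasoning.Setoid as SetoidReasoning
open import Relation.Binary.PropositionalEquality
open import Relation.Nullary using (Dec; yes; no)

-- Congruences of natural numbers

infix 4 _≡_[mod_]

record _≡_[mod_] (a b M : ℕ) : Set where
  constructor congruent
  field
    quotientˡ quotientʳ : ℕ
    equation : a + quotientˡ * M ≡ b + quotientʳ * M

module _ {M : ℕ} where

  ≡[mod]-reflexive : ∀ {a b} → a ≡ b → a ≡ b [mod M ]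
  ≡[mod]-reflexive refl = congruent 0 0 refl

  ≡[mod]-refl : ∀ {a} → a ≡ a [mod M ]
  ≡[mod]-refl = ≡[mod]-reflexive refl

  ≡[mod]-sym : ∀ {a b} → a ≡ b [mod M ] → b ≡ a [mod M ]
  ≡[mod]-sym (congruent x y e) = congruent y x (sym e)

  ≡[mod]-trans : ∀ {a b c} → a ≡ b [mod M ] → b ≡ c [mod M ] → a ≡ c [mod M ]
  ≡[mod]-trans {a} {b} {c} (congruent x y e) (congruent x′ y′ e′) = congruent (x + x′) (y′ + y) (begin
    a + (x + x′) * M      ≡⟨ shuffle a x x′ M ⟩
    (a + x * M) + x′ * M  ≡⟨ cong (_+ x′ * M) e ⟩
    (b + y * M) + x′ * M  ≡⟨ swap b y x′ M ⟩
    (b + x′ * M) + y * M  ≡⟨ cong (_+ y * M) e′ ⟩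
    (c + y′ * M) + y * M  ≡⟨ sym (shuffle c y′ y M) ⟩
    c + (y′ + y) * M      ∎)
    where
    open ≡-Reasoning
    shuffle : ∀ a x x′ M → a + (x + x′) * M ≡ (a + x * M) + x′ * M
    shuffle = solve-∀
    swap : ∀ b y x′ M → (b + y * M) + x′ * M ≡ (b + x′ * M) + y * M
    swap = solve-∀

  ≡[mod]-isEquivalence : IsEquivalence _≡_[mod M ]
  ≡[mod]-isEquivalence = record
    { refl = ≡[mod]-refl ; sym = ≡[mod]-sym ; trans = ≡[mod]-trans }

  +-cong-≡[mod] : ∀ {a b c d} → a ≡ b [mod M ] → c ≡ d [mod M ] → a + c ≡ b + d [mod M ]
  +-cong-≡[mod] {a} {b} {c} {d} (congruent x y e) (congruent x′ y′ e′) = congruent (x + x′) (y + y′) (begin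
    a + c + (x + x′) * M          ≡⟨ shuffle a c x x′ M ⟩
    (a + x * M) + (c + x′ * M)    ≡⟨ cong₂ _+_ e e′ ⟩
    (b + y * M) + (d + y′ * M)    ≡⟨ sym (shuffle b d y y′ M) ⟩
    b + d + (y + y′) * M          ∎)
    where
    open ≡-Reasoning
    shuffle : ∀ a c x x′ M → a + c + (x + x′) * M ≡ (a + x * M) + (c + x′ * M)
    shuffle = solve-∀

  +-cancelˡ-≡[mod] : ∀ a {b c} → a + b ≡ a + c [mod M ] → b ≡ c [mod M ]
  +-cancelˡ-≡[mod] a {b} {c} (congruent x y e) =
    congruent x y (+-cancelˡ-≡ a _ _ (trans (sym (+-assoc a b _)) (trans e (+-assoc a c _))))

  +-cancelʳ-≡[mod] : ∀ a {b c} → b + a ≡ c + a [mod M ] → b ≡ c [mod M ]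
  +-cancelʳ-≡[mod] a {b} {c} p =
    +-cancelˡ-≡[mod] a (subst₂ _≡_[mod M ] (+-comm b a) (+-comm c a) p)

  +-multiple-≡[mod] : ∀ a k → a + k * M ≡ a [mod M ]
  +-multiple-≡[mod] a k = congruent 0 k (+-identityʳ _)

  ∣-≡[mod] : ∀ {d a b} → d ∣ M → a ≡ b [mod M ] → a ≡ b [mod d ]
  ∣-≡[mod] {d} {a} {b} (divides q refl) (congruent x y e) = congruent (x * q) (y * q) (begin
    a + x * q * d      ≡⟨ cong (a +_) (*-assoc x q d) ⟩
    a + x * (q * d)    ≡⟨ e ⟩
    b + y * (q * d)    ≡⟨ cong (b +_) (sym (*-assoc y q d)) ⟩
    b + y * q * d      ∎)
    where open ≡-Reasoning

  *-cong-≡[mod] : ∀ c {a b} → a ≡ b [mod M ] → c * a ≡ c * b [mod c * M ]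
  *-cong-≡[mod] c {a} {b} (congruent x y e) = congruent x y (begin
    c * a + x * (c * M)   ≡⟨ scale c a x M ⟩
    c * (a + x * M)       ≡⟨ cong (c *_) e ⟩
    c * (b + y * M)       ≡⟨ sym (scale c b y M) ⟩
    c * b + y * (c * M)   ∎)
    where
    open ≡-Reasoning
    scale : ∀ c a x M → c * a + x * (c * M) ≡ c * (a + x * M)
    scale = solve-∀

  module _ .{{_ : NonZero M}} where

    %-≡⇒≡[mod] : ∀ {a b} → a % M ≡ b % M → a ≡ b [mod M ]
    %-≡⇒≡[mod] {a} {b} e = congruent (b / M) (a / M) (begin
      a + b / M * M                  ≡⟨ cong (_+ b / M * M) (m≡m%n+[m/n]*n a M) ⟩
      a % M + a / M * M + b / M * M  ≡⟨ cong (λ r → r + a / M * M + b / M * M) e ⟩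
      b % M + a / M * M + b / M * M  ≡⟨ swap (b % M) (a / M * M) (b / M * M) ⟩
      b % M + b / M * M + a / M * M  ≡⟨ cong (_+ a / M * M) (sym (m≡m%n+[m/n]*n b M)) ⟩
      b + a / M * M                  ∎)
      where
      open ≡-Reasoning
      swap : ∀ r u v → r + u + v ≡ r + v + u
      swap = solve-∀

    ≡[mod]⇒%-≡ : ∀ {a b} → a ≡ b [mod M ] → a % M ≡ b % M
    ≡[mod]⇒%-≡ {a} {b} (congruent x y e) = begin
      a % M              ≡⟨ sym ([m+kn]%n≡m%n a x M) ⟩
      (a + x * M) % M    ≡⟨ cong (_% M) e ⟩
      (b + y * M) % M    ≡⟨ [m+kn]%n≡m%n b y M ⟩
      b % M              ∎
      where open ≡-Reasoning

    ≡[mod]-solvable : ∀ a b → ∃[ k ] a + k ≡ b [mod M ]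
    ≡[mod]-solvable a b = (M ∸ a % M) + b , %-≡⇒≡[mod] (begin
      (a + (M ∸ a % M + b)) % M                  ≡⟨ cong (λ r → (r + (M ∸ a % M + b)) % M) (m≡m%n+[m/n]*n a M) ⟩
      (a % M + a / M * M + (M ∸ a % M + b)) % M  ≡⟨ cong (_% M) (regroup (a % M) (a / M * M) (M ∸ a % M) b) ⟩
      (b + (a % M + (M ∸ a % M)) + a / M * M) % M ≡⟨ cong (λ r → (b + r + a / M * M) % M) (m+[n∸m]≡n (<⇒≤ (m%n<n a M))) ⟩
      (b + M + a / M * M) % M                    ≡⟨ cong (_% M) (+-assoc b M _) ⟩
      (b + suc (a / M) * M) % M                  ≡⟨ [m+kn]%n≡m%n b (suc (a / M)) M ⟩
      b % M                                      ∎)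
      where
      open ≡-Reasoning
      regroup : ∀ r u v b → r + u + (v + b) ≡ b + (r + v) + u
      regroup = solve-∀

  ≡[mod]⇒≡ : ∀ {a b} → a < M → b < M → a ≡ b [mod M ] → a ≡ b
  ≡[mod]⇒≡ {a} {b} a<M b<M a≡b = begin
    a        ≡⟨ m<n⇒m%n≡m a<M ⟨
    a % M    ≡⟨ ≡[mod]⇒%-≡ a≡b ⟩
    b % M    ≡⟨ m<n⇒m%n≡m b<M ⟩
    b        ∎
    where
    open ≡-Reasoning
    instance _ = >-nonZero (≤-<-trans z≤n a<M)

module _ {M : ℕ} .{{_ : NonZero M}} where

  mod-≡⇒≡[mod] : ∀ {a} {r : Fin M} → a mod M ≡ r → a ≡ toℕ r [mod M ]
  mod-≡⇒≡[mod] {a} {r} refl = %-≡⇒≡[mod] (begin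
    a % M                 ≡⟨ toℕ-fromℕ< (m%n<n a M) ⟨
    toℕ (a mod M)         ≡⟨ m<n⇒m%n≡m (toℕ<n (a mod M)) ⟨
    toℕ (a mod M) % M     ∎)
    where open ≡-Reasoning

  ≡[mod]⇒mod-≡ : ∀ {a} {r : Fin M} → a ≡ toℕ r [mod M ] → a mod M ≡ r
  ≡[mod]⇒mod-≡ {a} {r} a≡r = toℕ-injective (begin
    toℕ (a mod M)   ≡⟨ toℕ-fromℕ< (m%n<n a M) ⟩
    a % M           ≡⟨ ≡[mod]⇒%-≡ a≡r ⟩
    toℕ r % M       ≡⟨ m<n⇒m%n≡m (toℕ<n r) ⟩
    toℕ r           ∎)
    where open ≡-Reasoning

≡[mod]-setoid : ℕ → Setoid _ _
≡[mod]-setoid M = record { isEquivalence = ≡[mod]-isEquivalence {M} }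

module ≡[mod]-Reasoning (M : ℕ) = SetoidReasoning (≡[mod]-setoid M)

/-≡[mod] : ∀ c {M a b u v} .{{_ : NonZero c}} → a % c ≡ b % c →
           a + c * u ≡ b + c * v [mod c * M ] → a / c + u ≡ b / c + v [mod M ]
/-≡[mod] c {M} {a} {b} {u} {v} a%c≡b%c (congruent x y e) = congruent x y
  (*-cancelˡ-≡ _ _ c (+-cancelˡ-≡ (b % c) _ _ (begin
    b % c + c * (a / c + u + x * M)       ≡⟨ cong (λ r → r + c * (a / c + u + x * M)) (sym a%c≡b%c) ⟩
    a % c + c * (a / c + u + x * M)       ≡⟨ expand (a % c) (a / c) c u x M ⟩
    a % c + a / c * c + c * u + x * (c * M) ≡⟨ cong (λ r → r + c * u + x * (c * M)) (sym (m≡m%n+[m/n]*n a c)) ⟩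
    a + c * u + x * (c * M)               ≡⟨ e ⟩
    b + c * v + y * (c * M)               ≡⟨ cong (λ r → r + c * v + y * (c * M)) (m≡m%n+[m/n]*n b c) ⟩
    b % c + b / c * c + c * v + y * (c * M) ≡⟨ sym (expand (b % c) (b / c) c v y M) ⟩
    b % c + c * (b / c + v + y * M)       ∎)))
  where
  open ≡-Reasoning
  expand : ∀ r q c u x M → r + c * (q + u + x * M) ≡ r + q * c + c * u + x * (c * M)
  expand = solve-∀

-- Chinese remaindering for moduli with a Bézout identity d + y N = x M: the
-- solution is k = c′ − c + y N (β − α), made non-negative by adding the
-- multiples M N c and y N M α.
private
  crt-+- : ∀ {d M N a a′ c c′} x y → d + y * suc N ≡ x * suc M →
           a + c′ ≡ a′ + c [mod d ] →
           ∃[ k ] (a + k ≡ a′ [mod suc M ]) × (c + k ≡ c′ [mod suc N ])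
  crt-+- {d} {M} {N} {a} {a′} {c} {c′} x y bézout (congruent α β hyp) =
    k , congruent (x * α) Q first ,
        congruent 0 (suc M * c + y * (β + M * α)) second
    where
    open ≡-Reasoning
    k = c′ + (M * suc N + N) * c + y * suc N * (β + M * α)
    Q = suc N * c + x * β + y * suc N * α
    T = c + α * d + y * suc N * α
    R = suc M * suc N * c + y * suc N * β + y * suc N * suc M * α + x * α * suc M

    first : a + k + x * α * suc M ≡ a′ + Q * suc M
    first = +-cancelʳ-≡ T _ _ (begin
      a + k + x * α * suc M + T                         ≡⟨ step₁ a c c′ d x y α β M N ⟩
      a + c′ + α * d + R                                ≡⟨ cong (_+ R) hyp ⟩
      a′ + c + β * d + R                                ≡⟨ step₂ a′ c d x y α β M N ⟩
      a′ + c + β * (d + y * suc N) + R′                 ≡⟨ cong (λ r → a′ + c + β * r + R′) bézout ⟩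
      a′ + c + β * (x * suc M) + R′                     ≡⟨ step₃ a′ c x y α β M N ⟩
      a′ + Q * suc M + c + α * (x * suc M)              ≡⟨ cong (λ r → a′ + Q * suc M + c + α * r) bézout ⟨
      a′ + Q * suc M + c + α * (d + y * suc N)          ≡⟨ step₄ a′ c d x y α β M N ⟩
      a′ + Q * suc M + T                                ∎)
      where
      R′ = suc M * suc N * c + y * suc N * suc M * α + x * α * suc M
      step₁ : ∀ a c c′ d x y α β M N →
        a + (c′ + (M * suc N + N) * c + y * suc N * (β + M * α)) + x * α * suc M
          + (c + α * d + y * suc N * α)
        ≡ a + c′ + α * d + (suc M * suc N * c + y * suc N * β
          + y * suc N * suc M * α + x * α * suc M)
      step₁ = solve-∀
      step₂ : ∀ a′ c d x y α β M N →
        a′ + c + β * d + (suc M * suc N * c + y * suc N * β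
          + y * suc N * suc M * α + x * α * suc M)
        ≡ a′ + c + β * (d + y * suc N)
          + (suc M * suc N * c + y * suc N * suc M * α + x * α * suc M)
      step₂ = solve-∀
      step₃ : ∀ a′ c x y α β M N →
        a′ + c + β * (x * suc M)
          + (suc M * suc N * c + y * suc N * suc M * α + x * α * suc M)
        ≡ a′ + (suc N * c + x * β + y * suc N * α) * suc M + c + α * (x * suc M)
      step₃ = solve-∀
      step₄ : ∀ a′ c d x y α β M N →
        a′ + (suc N * c + x * β + y * suc N * α) * suc M + c + α * (d + y * suc N)
        ≡ a′ + (suc N * c + x * β + y * suc N * α) * suc M
          + (c + α * d + y * suc N * α)
      step₄ = solve-∀

    second : c + k + 0 * suc N ≡ c′ + (suc M * c + y * (β + M * α)) * suc N
    second = expand c c′ y α β M N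
      where
      expand : ∀ c c′ y α β M N →
        c + (c′ + (M * suc N + N) * c + y * suc N * (β + M * α)) + 0 * suc N
        ≡ c′ + (suc M * c + y * (β + M * α)) * suc N
      expand = solve-∀

crt : ∀ {d M N a a′ c c′} → Bézout.Identity d (suc M) (suc N) →
      a + c′ ≡ a′ + c [mod d ] →
      ∃[ k ] (a + k ≡ a′ [mod suc M ]) × (c + k ≡ c′ [mod suc N ])
crt (Bézout.+- x y eq) hyp = crt-+- x y eq hyp
crt {d} {a = a} {a′} {c} {c′} (Bézout.-+ x y eq) hyp
  with k , c+k≡c′ , a+k≡a′ ← crt-+- y x eq
         (≡[mod]-sym (subst₂ (λ u v → u ≡ v [mod d ]) (+-comm a c′) (+-comm a′ c) hyp))
  = k , a+k≡a′ , c+k≡c′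

odd-≢-multiple : ∀ {X X′ k} → X ≡ X′ [mod 4 ] → X + suc X′ ≡ 4 * k → ⊥
odd-≢-multiple {X} {X′} {k} (congruent x y e) sum = even≢odd (2 * (k + x)) (X′ + 2 * y) (begin
  2 * (2 * (k + x))       ≡⟨ expand k x ⟩
  4 * k + x * 4           ≡⟨ cong (_+ x * 4) (sym sum) ⟩
  X + suc X′ + x * 4      ≡⟨ regroup X X′ x ⟩
  suc (X + x * 4 + X′)    ≡⟨ cong (λ r → suc (r + X′)) e ⟩
  suc (X′ + y * 4 + X′)   ≡⟨ cong suc (collect X′ y) ⟩
  suc (2 * (X′ + 2 * y))  ∎)
  where
  open ≡-Reasoning
  expand : ∀ k x → 2 * (2 * (k + x)) ≡ 4 * k + x * 4
  expand = solve-∀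
  regroup : ∀ X X′ x → X + suc X′ + x * 4 ≡ suc (X + x * 4 + X′)
  regroup = solve-∀
  collect : ∀ X′ y → X′ + y * 4 + X′ ≡ 2 * (X′ + 2 * y)
  collect = solve-∀

twice-odd-≢-multiple : ∀ {X Y X′ Y′ b k l} → X + Y ≡ 2 * b [mod 4 ] → X′ + Y′ ≡ 2 * b [mod 4 ] →
                       X + suc X′ ≡ 4 * k → Y + suc Y′ ≡ 4 * l → ⊥
twice-odd-≢-multiple {X} {Y} {X′} {Y′} {b} {k} {l} (congruent x y e) (congruent x′ y′ e′) sumX sumY =
  even≢odd (k + l + x + x′) (b + y + y′) (*-cancelˡ-≡ _ _ 2 (begin
    2 * (2 * (k + l + x + x′))                       ≡⟨ expand k l x x′ ⟩
    4 * k + 4 * l + x * 4 + x′ * 4                   ≡⟨ cong₂ (λ u v → u + v + x * 4 + x′ * 4) (sym sumX) (sym sumY) ⟩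
    X + suc X′ + (Y + suc Y′) + x * 4 + x′ * 4        ≡⟨ regroup X Y X′ Y′ x x′ ⟩
    2 + (X + Y + x * 4) + (X′ + Y′ + x′ * 4)          ≡⟨ cong₂ (λ u v → 2 + u + v) e e′ ⟩
    2 + (2 * b + y * 4) + (2 * b + y′ * 4)            ≡⟨ collect b y y′ ⟩
    2 * suc (2 * (b + y + y′))                       ∎))
  where
  open ≡-Reasoning
  expand : ∀ k l x x′ → 2 * (2 * (k + l + x + x′)) ≡ 4 * k + 4 * l + x * 4 + x′ * 4
  expand = solve-∀
  regroup : ∀ X Y X′ Y′ x x′ →
    X + suc X′ + (Y + suc Y′) + x * 4 + x′ * 4 ≡ 2 + (X + Y + x * 4) + (X′ + Y′ + x′ * 4)
  regroup = solve-∀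
  collect : ∀ b y y′ → 2 + (2 * b + y * 4) + (2 * b + y′ * 4) ≡ 2 * suc (2 * (b + y + y′))
  collect = solve-∀

module _ {A : Set} where

  iter-commute : ∀ {B : Set} {f : A → A} {f′ : B → B} (h : A → B) →
                 (∀ x → h (f x) ≡ f′ (h x)) → ∀ k x → h (iter k f x) ≡ iter k f′ (h x)
  iter-commute h comm zero x = refl
  iter-commute {f = f} {f′} h comm (suc k) x =
    trans (comm (iter k f x)) (cong f′ (iter-commute h comm k x))

  iter-inverse : ∀ {f f′ : A → A} → (∀ x → f (f′ x) ≡ x) → ∀ k x → iter k f (iter k f′ x) ≡ x
  iter-inverse inv zero x = refl
  iter-inverse {f} {f′} inv (suc k) x = begin
    f (iter k f (f′ (iter k f′ x)))  ≡⟨ iter-commute f (λ _ → refl) k (f′ (iter k f′ x)) ⟩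
    iter k f (f (f′ (iter k f′ x)))  ≡⟨ cong (iter k f) (inv (iter k f′ x)) ⟩
    iter k f (iter k f′ x)           ≡⟨ iter-inverse inv k x ⟩
    x                                ∎
    where open ≡-Reasoning

  iter-invariant : ∀ {B : Set} {f : A → A} (h : A → B) → (∀ x → h (f x) ≡ h x) → ∀ k x → h (iter k f x) ≡ h x
  iter-invariant h inv zero    x = refl
  iter-invariant {f = f} h inv (suc k) x = trans (inv (iter k f x)) (iter-invariant h inv k x)

  iter-≡[mod] : ∀ {f : A → A} (φ : A → ℕ) {M a} → (∀ x → φ (f x) ≡ a + φ x [mod M ]) →
                ∀ k x → φ (iter k f x) ≡ k * a + φ x [mod M ]
  iter-≡[mod] φ step zero    x = ≡[mod]-refl
  iter-≡[mod] {f} φ {M} {a} step (suc k) x = begin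
    φ (f (iter k f x))        ≈⟨ step (iter k f x) ⟩
    a + φ (iter k f x)        ≈⟨ +-cong-≡[mod] (≡[mod]-refl {a = a}) (iter-≡[mod] φ step k x) ⟩
    a + (k * a + φ x)         ≡⟨ +-assoc a (k * a) (φ x) ⟨
    a + k * a + φ x           ∎
    where open ≡[mod]-Reasoning M

sumFin-cong : ∀ k {f h : Fin k → ℕ} → (∀ i → f i ≡ h i) → sumFin k f ≡ sumFin k h
sumFin-cong zero    f≗h = refl
sumFin-cong (suc k) f≗h = cong₂ _+_ (f≗h zero) (sumFin-cong k (f≗h ∘ suc))

sumFin-↑ : ∀ a b (f : Fin (a + b) → ℕ) →
           sumFin (a + b) f ≡ sumFin a (λ i → f (i ↑ˡ b)) + sumFin b (λ j → f (a ↑ʳ j))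
sumFin-↑ zero    b f = refl
sumFin-↑ (suc a) b f =
  trans (cong (f zero +_) (sumFin-↑ a b (f ∘ suc))) (sym (+-assoc (f zero) _ _))

sumFin-combine : ∀ a b (f : Fin (a * b) → ℕ) →
                 sumFin (a * b) f ≡ sumFin a (λ i → sumFin b (λ j → f (combine i j)))
sumFin-combine zero    b f = refl
sumFin-combine (suc a) b f =
  trans (sumFin-↑ b (a * b) f)
    (cong (sumFin b (λ j → f (j ↑ˡ a * b)) +_) (sumFin-combine a b (λ k → f (b ↑ʳ k))))

sumFin-permute : ∀ k (f : Fin k → ℕ) (π π⁻¹ : Fin k → Fin k) →
                 (∀ i → π (π⁻¹ i) ≡ i) → (∀ i → π⁻¹ (π i) ≡ i) →
                 sumFin k (f ∘ π) ≡ sumFin k f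
sumFin-permute k f π π⁻¹ inv inv′ = begin
  sumFin k (f ∘ π)  ≡⟨ sumFin-sum k (f ∘ π) ⟩
  Σ.sum (f ∘ π)     ≡⟨ Σ.sum-permute f (permutation π π⁻¹ inv inv′) ⟨
  Σ.sum f           ≡⟨ sumFin-sum k f ⟨
  sumFin k f        ∎
  where
  open ≡-Reasoning
  module Σ = CommutativeMonoidSum +-0-commutativeMonoid
  sumFin-sum : ∀ k (f : Fin k → ℕ) → sumFin k f ≡ Σ.sum f
  sumFin-sum zero    f = refl
  sumFin-sum (suc k) f = cong (f zero +_) (sumFin-sum k (f ∘ suc))

sumState : ∀ n m → (State n m → ℕ) → ℕ
sumState n m f = sumCircles n m (λ c → sumFin 4 (λ q → f (c , q)))

module _ {n m : ℕ} where

  sumState-cong : ∀ {f h : State n m → ℕ} → (∀ s → f s ≡ h s) → sumState n m f ≡ sumState n m h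
  sumState-cong f≗h =
    sumFin-cong n (λ i → sumFin-cong m (λ j → sumFin-cong 4 (λ q → f≗h ((i , j) , q))))

  private
    encode : State n m → Fin (n * (m * 4))
    encode ((i , j) , q) = combine i (combine j q)

    decode : Fin (n * (m * 4)) → State n m
    decode k = (proj₁ ij , proj₁ jq) , proj₂ jq
      where
      ij = remQuot {n} (m * 4) k
      jq = remQuot {m} 4 (proj₂ ij)

    decode-encode : ∀ s → decode (encode s) ≡ s
    decode-encode ((i , j) , q) = begin
      decode (combine i (combine j q))   ≡⟨ cong split (remQuot-combine {n} {m * 4} i (combine j q)) ⟩
      (i , proj₁ jq) , proj₂ jq          ≡⟨ cong (λ (j , q) → (i , j) , q) (remQuot-combine {m} {4} j q) ⟩
      (i , j) , q                        ∎
      where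
      open ≡-Reasoning
      jq = remQuot {m} 4 (combine j q)
      split : Fin n × Fin (m * 4) → State n m
      split (i , k) = (i , proj₁ (remQuot {m} 4 k)) , proj₂ (remQuot {m} 4 k)

    encode-decode : ∀ k → encode (decode k) ≡ k
    encode-decode k = begin
      combine i (combine j q)                   ≡⟨ cong (combine i) (combine-remQuot {m} 4 k′) ⟩
      combine i k′                              ≡⟨ combine-remQuot {n} (m * 4) k ⟩
      k                                         ∎
      where
      open ≡-Reasoning
      i = proj₁ (remQuot {n} (m * 4) k)
      k′ = proj₂ (remQuot {n} (m * 4) k)
      j = proj₁ (remQuot {m} 4 k′)
      q = proj₂ (remQuot {m} 4 k′)

    sumState-flatten : ∀ f → sumState n m f ≡ sumFin (n * (m * 4)) (f ∘ decode)
    sumState-flatten f = sym (begin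
      sumFin (n * (m * 4)) (f ∘ decode)
        ≡⟨ sumFin-combine n (m * 4) (f ∘ decode) ⟩
      sumFin n (λ i → sumFin (m * 4) (λ k → f (decode (combine i k))))
        ≡⟨ sumFin-cong n (λ i → sumFin-combine m 4 _) ⟩
      sumFin n (λ i → sumFin m (λ j → sumFin 4 (λ q → f (decode (encode ((i , j) , q))))))
        ≡⟨ sumState-cong (cong f ∘ decode-encode) ⟩
      sumState n m f ∎)
      where open ≡-Reasoning

  sumState-reindex : ∀ (f : State n m → ℕ) (σ σ⁻¹ : State n m → State n m) →
                     (∀ s → σ (σ⁻¹ s) ≡ s) → (∀ s → σ⁻¹ (σ s) ≡ s) →
                     sumState n m (f ∘ σ) ≡ sumState n m f
  sumState-reindex f σ σ⁻¹ inv inv′ = begin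
    sumState n m (f ∘ σ)                          ≡⟨ sumState-flatten (f ∘ σ) ⟩
    sumFin (n * (m * 4)) (f ∘ σ ∘ decode)         ≡⟨ sumFin-cong _ (λ k → cong f (sym (decode-encode (σ (decode k))))) ⟩
    sumFin (n * (m * 4)) (f ∘ decode ∘ π)         ≡⟨ sumFin-permute _ (f ∘ decode) π π⁻¹ (round-trip {σ} {σ⁻¹} inv) (round-trip {σ⁻¹} {σ} inv′) ⟩
    sumFin (n * (m * 4)) (f ∘ decode)             ≡⟨ sumState-flatten f ⟨
    sumState n m f                                ∎
    where
    open ≡-Reasoning
    π π⁻¹ : Fin (n * (m * 4)) → Fin (n * (m * 4))
    π = encode ∘ σ ∘ decode
    π⁻¹ = encode ∘ σ⁻¹ ∘ decode
    round-trip : ∀ {τ τ′ : State n m → State n m} → (∀ s → τ (τ′ s) ≡ s) →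
                 ∀ k → encode (τ (decode (encode (τ′ (decode k))))) ≡ k
    round-trip {τ} {τ′} inv k = begin
      encode (τ (decode (encode (τ′ (decode k)))))  ≡⟨ cong (encode ∘ τ) (decode-encode _) ⟩
      encode (τ (τ′ (decode k)))                    ≡⟨ cong encode (inv (decode k)) ⟩
      encode (decode k)                             ≡⟨ encode-decode k ⟩
      k                                             ∎

ind-cong : ∀ {P Q : Set} (p : Dec P) (q : Dec Q) → (P → Q) → (Q → P) → ind p ≡ ind q
ind-cong (yes _) (yes _) _   _   = refl
ind-cong (yes p) (no ¬q) p→q _   = ⊥-elim (¬q (p→q p))
ind-cong (no ¬p) (yes q) _   q→p = ⊥-elim (¬p (q→p q))
ind-cong (no _)  (no _)  _   _   = refl

-- Tracks

bit : Bool → ℕ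
bit false = 0
bit true  = 1

isOdd : ℕ → Bool
isOdd zero    = false
isOdd (suc t) = not (isOdd t)

down-just : ∀ {k} (j j′ : Fin k) → down j ≡ just j′ → toℕ j′ ≡ suc (toℕ j)
down-just {suc (suc k)} zero .(suc zero) refl = refl
down-just {suc (suc k)} (suc i) j′ eq with down i in e
down-just {suc (suc k)} (suc i) .(suc i′) refl | just i′ = cong suc (down-just i i′ e)

down-nothing : ∀ {k} (j : Fin k) → down j ≡ nothing → suc (toℕ j) ≡ k
down-nothing {suc zero} zero eq = refl
down-nothing {suc (suc k)} (suc i) eq with down i in e
... | nothing = cong suc (down-nothing i e)

up-just : ∀ {k} (j j′ : Fin k) → up j ≡ just j′ → suc (toℕ j′) ≡ toℕ j
up-just (suc i) .(inject₁ i) refl = cong suc (toℕ-inject₁ i)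

up-nothing : ∀ {k} (j : Fin k) → up j ≡ nothing → toℕ j ≡ 0
up-nothing zero eq = refl

double+bit-injective : ∀ a b x y → 2 * a + bit x ≡ 2 * b + bit y → a ≡ b × x ≡ y
double+bit-injective a b false false e =
  *-cancelˡ-≡ a b 2 (trans (sym (+-identityʳ _)) (trans e (+-identityʳ _))) , refl
double+bit-injective a b true  true  e = *-cancelˡ-≡ a b 2 (+-cancelʳ-≡ 1 _ _ e) , refl
double+bit-injective a b false true  e =
  ⊥-elim (even≢odd a b (trans (sym (+-identityʳ _)) (trans e (+-comm _ 1))))
double+bit-injective a b true  false e =
  ⊥-elim (even≢odd b a (trans (sym (+-identityʳ _)) (trans (sym e) (+-comm _ 1))))

double+bit-< : ∀ {t k} → t < k → ∀ x → 2 * t + bit x < 2 * k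
double+bit-< {t} {k} t<k x = begin-strict
  2 * t + bit x  ≤⟨ +-monoʳ-≤ (2 * t) (bit≤1 x) ⟩
  2 * t + 1      <⟨ +-monoʳ-< (2 * t) (s≤s (s≤s z≤n)) ⟩
  2 * t + 2      ≡⟨ +-comm (2 * t) 2 ⟩
  2 + 2 * t      ≡⟨ *-suc 2 t ⟨
  2 * suc t      ≤⟨ *-monoʳ-≤ 2 t<k ⟩
  2 * k          ∎
  where
  open ≤-Reasoning
  bit≤1 : ∀ x → bit x ≤ 1
  bit≤1 false = z≤n
  bit≤1 true  = s≤s z≤n

digit : Bool → Bool → ℕ
digit h l = 2 * bit h + bit l

double-≡[mod4] : ∀ t → 2 * t ≡ 2 * bit (isOdd t) [mod 4 ]
double-≡[mod4] zero    = ≡[mod]-refl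
double-≡[mod4] (suc t) = begin
  2 * suc t                   ≡⟨ *-suc 2 t ⟩
  2 + 2 * t                   ≈⟨ +-cong-≡[mod] (≡[mod]-refl {a = 2}) (double-≡[mod4] t) ⟩
  2 + 2 * bit (isOdd t)       ≈⟨ two-plus (isOdd t) ⟩
  2 * bit (not (isOdd t))     ∎
  where
  open ≡[mod]-Reasoning 4
  two-plus : ∀ b → 2 + 2 * bit b ≡ 2 * bit (not b) [mod 4 ]
  two-plus false = ≡[mod]-refl
  two-plus true  = congruent 0 1 refl

bit+bit-not : ∀ b → bit b + bit (not b) ≡ 1
bit+bit-not false = refl
bit+bit-not true  = refl

mirror-+ : ∀ {k} (j : Fin k) → toℕ (mirror j) + suc (toℕ j) ≡ k
mirror-+ {k} j = trans (cong (_+ suc (toℕ j)) (mirror-prop j)) (m∸n+n≡m (toℕ<n j))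

-- One coordinate of the moving point walks along a line of k cells (the
-- circles of a row or column) and is reflected at both ends.  A track records
-- the cell, which half of it the point is in, and whether the walk currently
-- runs backwards; unfolding the reflections, the walk runs around a cycle of
-- 4 k half-cells, and position is the place on that cycle.
Track : ℕ → Set
Track k = Fin k × Bool × Bool

module _ {k : ℕ} where

  advance : Track k → Track k
  advance (j , false , false) = j , true , false
  advance (j , true , false) with down j
  ... | just j′ = j′ , false , false
  ... | nothing = j , true , true
  advance (j , true , true) = j , false , true
  advance (j , false , true) with up j
  ... | just j′ = j′ , true , true
  ... | nothing = j , false , false

  reflect : Track k → Track k
  reflect (j , δ , e) = j , δ , not e

  reflect-involutive : ∀ a → reflect (reflect a) ≡ a
  reflect-involutive (j , δ , false) = refl
  reflect-involutive (j , δ , true)  = refl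

  position : Track k → ℕ
  position (j , δ , false) = 2 * toℕ j + bit δ
  position (j , δ , true)  = 2 * k + 2 * toℕ (mirror j) + bit (not δ)

  position-reflect : ∀ a → position a + suc (position (reflect a)) ≡ 4 * k
  position-reflect (j , δ , false) =
    subst (λ K → 2 * t + bit δ + suc (2 * K + 2 * o + bit (not δ)) ≡ 4 * K) (mirror-+ j)
      (begin
        2 * t + bit δ + suc (2 * (o + suc t) + 2 * o + bit (not δ))  ≡⟨ regroup t o (bit δ) (bit (not δ)) ⟩
        4 * (o + t) + 3 + (bit δ + bit (not δ))                      ≡⟨ cong (4 * (o + t) + 3 +_) (bit+bit-not δ) ⟩
        4 * (o + t) + 3 + 1                                          ≡⟨ collect o t ⟩
        4 * (o + suc t)                                              ∎)
    where
    open ≡-Reasoning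
    t = toℕ j
    o = toℕ (mirror j)
    regroup : ∀ t o d d′ → 2 * t + d + suc (2 * (o + suc t) + 2 * o + d′) ≡ 4 * (o + t) + 3 + (d + d′)
    regroup = solve-∀
    collect : ∀ o t → 4 * (o + t) + 3 + 1 ≡ 4 * (o + suc t)
    collect = solve-∀
  position-reflect (j , δ , true) = begin
    b + suc f    ≡⟨ +-suc b f ⟩
    suc (b + f)  ≡⟨ cong suc (+-comm b f) ⟩
    suc (f + b)  ≡⟨ +-suc f b ⟨
    f + suc b    ≡⟨ position-reflect (j , δ , false) ⟩
    4 * k        ∎
    where
    open ≡-Reasoning
    b = position (j , δ , true)
    f = position (j , δ , false)

  position-< : ∀ a → position a < 4 * k
  position-< a = subst (position a <_) (position-reflect a) (m<m+n (position a) z<s)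

  private
    backwards-suc : ∀ {j j′ : Fin k} {δ δ′} →
                    suc (position (j , δ , false)) ≡ position (j′ , δ′ , false) →
                    position (j , δ , true) ≡ suc (position (j′ , δ′ , true))
    backwards-suc {j} {j′} {δ} {δ′} forwards = +-cancelʳ-≡ (suc (position (j′ , δ′ , false))) _ _ (begin
      position (j , δ , true) + suc (position (j′ , δ′ , false))       ≡⟨ cong (λ p → position (j , δ , true) + suc p) forwards ⟨
      position (j , δ , true) + suc (suc (position (j , δ , false)))   ≡⟨ +-suc _ _ ⟩
      suc (position (j , δ , true) + suc (position (j , δ , false)))   ≡⟨ cong suc (position-reflect (j , δ , true)) ⟩
      suc (4 * k)                                                      ≡⟨ cong suc (position-reflect (j′ , δ′ , true)) ⟨
      suc (position (j′ , δ′ , true) + suc (position (j′ , δ′ , false))) ∎)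
      where open ≡-Reasoning

    forwards-half : ∀ t → suc (2 * t + bit false) ≡ 2 * t + bit true
    forwards-half t = trans (cong suc (+-identityʳ (2 * t))) (+-comm 1 (2 * t))

    forwards-cell : ∀ t t′ → t′ ≡ suc t → suc (2 * t + bit true) ≡ 2 * t′ + bit false
    forwards-cell t .(suc t) refl = double-suc t
      where
      double-suc : ∀ t → suc (2 * t + 1) ≡ 2 * suc t + 0
      double-suc = solve-∀

  position-advance : ∀ a → position (advance a) ≡ suc (position a) [mod 4 * k ]
  position-advance (j , false , false) = ≡[mod]-reflexive (sym (forwards-half (toℕ j)))
  position-advance (j , true , false) with down j in e
  ... | just j′ = ≡[mod]-reflexive (sym (forwards-cell (toℕ j) (toℕ j′) (down-just j j′ e)))
  ... | nothing = ≡[mod]-reflexive (+-cancelʳ-≡ (suc (2 * t + 1)) _ _ (begin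
    position (j , true , true) + suc (2 * t + 1)  ≡⟨ position-reflect (j , true , true) ⟩
    4 * k                                         ≡⟨ cong (4 *_) (down-nothing j e) ⟨
    4 * suc t                                     ≡⟨ twice t ⟩
    suc (2 * t + 1) + suc (2 * t + 1)             ∎))
    where
    open ≡-Reasoning
    t = toℕ j
    twice : ∀ t → 4 * suc t ≡ suc (2 * t + 1) + suc (2 * t + 1)
    twice = solve-∀
  position-advance (j , true , true) = ≡[mod]-reflexive (backwards-suc (forwards-half (toℕ j)))
  position-advance (j , false , true) with up j in e
  ... | just j′ =
    ≡[mod]-reflexive (backwards-suc (forwards-cell (toℕ j′) (toℕ j) (sym (up-just j j′ e))))
  ... | nothing = congruent 1 0 (begin
    2 * toℕ j + 0 + 1 * (4 * k)                     ≡⟨ cong (λ t → 2 * t + 0 + 1 * (4 * k)) (up-nothing j e) ⟩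
    1 * (4 * k)                                     ≡⟨ +-identityʳ (4 * k) ⟩
    4 * k                                           ≡⟨ position-reflect (j , false , true) ⟨
    position (j , false , true) + suc (2 * toℕ j + 0) ≡⟨ cong (λ t → position (j , false , true) + suc (2 * t + 0)) (up-nothing j e) ⟩
    position (j , false , true) + 1                 ≡⟨ trans (+-comm _ 1) (sym (+-identityʳ _)) ⟩
    suc (position (j , false , true)) + 0 * (4 * k)  ∎)
    where open ≡-Reasoning

  position-injective : ∀ a b → position a ≡ position b → a ≡ b
  position-injective (j , δ , false) (j′ , δ′ , false) e
    with t≡t′ , refl ← double+bit-injective _ _ δ δ′ e = cong (_, δ , false) (toℕ-injective t≡t′)
  position-injective (j , δ , true) (j′ , δ′ , true) e
    with o≡o′ , nδ≡nδ′ ← double+bit-injective _ _ (not δ) (not δ′)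
           (+-cancelˡ-≡ (2 * k) _ _ (trans (sym (+-assoc (2 * k) _ _)) (trans e (+-assoc (2 * k) _ _))))
    = cong₂ (λ j δ → j , δ , true) (mirror-injective (toℕ-injective o≡o′)) (not-injective nδ≡nδ′)
    where
    mirror-injective : ∀ {j j′ : Fin k} → mirror j ≡ mirror j′ → j ≡ j′
    mirror-injective {j} {j′} e =
      trans (sym (mirror-involutive j)) (trans (cong mirror e) (mirror-involutive j′))
  position-injective (j , δ , false) (j′ , δ′ , true) e =
    ⊥-elim (<⇒≱ (double+bit-< (toℕ<n j) δ) (subst (2 * k ≤_) (sym e) (m≤m+n+o (2 * k) _ _)))
    where
    m≤m+n+o : ∀ m n o → m ≤ m + n + o
    m≤m+n+o m n o = ≤-trans (m≤m+n m n) (m≤m+n (m + n) o)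
  position-injective (j , δ , true) (j′ , δ′ , false) e =
    sym (position-injective (j′ , δ′ , false) (j , δ , true) (sym e))

  highBit lowBit : Track k → Bool
  highBit (j , δ , e) = e xor isOdd (toℕ j)
  lowBit  (j , δ , e) = e xor δ

  position-digit : ∀ a → position a ≡ digit (highBit a) (lowBit a) [mod 4 ]
  position-digit (j , δ , false) = +-cong-≡[mod] (double-≡[mod4] (toℕ j)) (≡[mod]-refl {a = bit δ})
  position-digit (j , δ , true) = begin
    2 * k + 2 * o + bit (not δ)                ≡⟨ cong (λ K → 2 * K + 2 * o + bit (not δ)) (mirror-+ j) ⟨
    2 * (o + suc t) + 2 * o + bit (not δ)      ≡⟨ regroup o t (bit (not δ)) ⟩
    2 * suc t + bit (not δ) + o * 4            ≈⟨ +-multiple-≡[mod] _ o ⟩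
    2 * suc t + bit (not δ)                    ≈⟨ +-cong-≡[mod] (double-≡[mod4] (suc t)) (≡[mod]-refl {a = bit (not δ)}) ⟩
    2 * bit (isOdd (suc t)) + bit (not δ)      ∎
    where
    open ≡[mod]-Reasoning 4
    t = toℕ j
    o = toℕ (mirror j)
    regroup : ∀ o t d → 2 * (o + suc t) + 2 * o + d ≡ 2 * suc t + d + o * 4
    regroup = solve-∀

  reflect-or-same : ∀ (j : Fin k) δ e e′ → (j , δ , e′) ≡ (j , δ , e) ⊎ (j , δ , e′) ≡ reflect (j , δ , e)
  reflect-or-same j δ false false = inj₁ refl
  reflect-or-same j δ false true  = inj₂ refl
  reflect-or-same j δ true  false = inj₂ refl
  reflect-or-same j δ true  true  = inj₁ refl

  jump : Track k → Track k
  jump = iter 4 advance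

  position-jump : ∀ a → position (jump a) ≡ 4 + position a [mod 4 * k ]
  position-jump = iter-≡[mod] {f = advance} position position-advance 4

  jump-period : ∀ a → iter k jump a ≡ a
  jump-period a = position-injective _ a (≡[mod]⇒≡ (position-< (iter k jump a)) (position-< a) (begin
    position (iter k jump a)    ≈⟨ iter-≡[mod] {f = jump} position position-jump k a ⟩
    k * 4 + position a          ≡⟨ +-comm (k * 4) (position a) ⟩
    position a + k * 4          ≡⟨ cong (position a +_) (trans (*-comm k 4) (sym (*-identityˡ (4 * k)))) ⟩
    position a + 1 * (4 * k)    ≈⟨ +-multiple-≡[mod] (position a) 1 ⟩
    position a                  ∎))
    where open ≡[mod]-Reasoning (4 * k)

  position-reflect-≡[mod] : ∀ {a b t} → position b ≡ t + position a [mod 4 * k ] →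
                            position (reflect b) + t ≡ position (reflect a) [mod 4 * k ]
  position-reflect-≡[mod] {a} {b} {t} b≡t+a = +-cancelʳ-≡[mod] (suc (position a)) (begin
    position (reflect b) + t + suc (position a)   ≡⟨ regroup (position (reflect b)) t (position a) ⟩
    suc (position (reflect b)) + (t + position a) ≈⟨ +-cong-≡[mod] (≡[mod]-refl {a = suc (position (reflect b))}) (≡[mod]-sym b≡t+a) ⟩
    suc (position (reflect b)) + position b       ≡⟨ +-comm (suc (position (reflect b))) (position b) ⟩
    position b + suc (position (reflect b))       ≡⟨ position-reflect b ⟩
    4 * k                                         ≡⟨ position-reflect a ⟨
    position a + suc (position (reflect a))       ≡⟨ +-comm (position a) (suc (position (reflect a))) ⟩
    suc (position (reflect a)) + position a       ≡⟨ +-suc (position (reflect a)) (position a) ⟨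
    position (reflect a) + suc (position a)       ∎)
    where
    open ≡[mod]-Reasoning (4 * k)
    regroup : ∀ r t p → r + t + suc p ≡ suc r + (t + p)
    regroup = solve-∀

  position-jump-≡[mod4] : ∀ a → position (jump a) ≡ position a [mod 4 ]
  position-jump-≡[mod4] a = ≡[mod]-trans (∣-≡[mod] (divides k (*-comm 4 k)) (position-jump a))
    (subst (_≡ position a [mod 4 ]) (+-comm (position a) (1 * 4)) (+-multiple-≡[mod] (position a) 1))

  -- 1 exactly when the walk is about to be reflected at the low (high) end.
  lowEndHit highEndHit : Track k → ℕ
  lowEndHit  (j , δ , e) = ind (toℕ j ≟ 0) * bit (not δ ∧ e)
  highEndHit (j , δ , e) = ind (suc (toℕ j) ≟ k) * bit (δ ∧ not e)

-- Reflecting one track changes the parity of the sum of the positions;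
-- reflecting both adds 2 to it modulo 4.
same-parity⇒unreflected : ∀ {k l c} {a a′ : Track k} {b b′ : Track l} →
  position a + position b ≡ 2 * c [mod 4 ] → position a′ + position b′ ≡ 2 * c [mod 4 ] →
  a′ ≡ a ⊎ a′ ≡ reflect a → b′ ≡ b ⊎ b′ ≡ reflect b → a′ ≡ a × b′ ≡ b
same-parity⇒unreflected p p′ (inj₁ a′≡a) (inj₁ b′≡b) = a′≡a , b′≡b
same-parity⇒unreflected {k} {a = a} {b = b} p p′ (inj₂ refl) (inj₁ refl) = ⊥-elim (odd-≢-multiple {k = k}
  (+-cancelʳ-≡[mod] (position b) (≡[mod]-trans p (≡[mod]-sym p′))) (position-reflect a))
same-parity⇒unreflected {l = l} {a = a} {b = b} p p′ (inj₁ refl) (inj₂ refl) = ⊥-elim (odd-≢-multiple {k = l}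
  (+-cancelˡ-≡[mod] (position a) (≡[mod]-trans p (≡[mod]-sym p′))) (position-reflect b))
same-parity⇒unreflected {k} {l} {c} {a = a} {b = b} p p′ (inj₂ refl) (inj₂ refl) =
  ⊥-elim (twice-odd-≢-multiple {b = c} {k = k} {l = l} p p′ (position-reflect a) (position-reflect b))

-- Quarter arcs and rings

flipDir : Dir → Dir
flipDir ccw = cw
flipDir cw  = ccw

isCcw : Dir → Bool
isCcw ccw = true
isCcw cw  = false

inEastHalf inSouthHalf : Fin 4 → Bool
inEastHalf zero                   = true
inEastHalf (suc zero)             = false
inEastHalf (suc (suc zero))       = false
inEastHalf (suc (suc (suc zero))) = true
inSouthHalf zero                   = false
inSouthHalf (suc zero)             = false
inSouthHalf (suc (suc zero))       = true
inSouthHalf (suc (suc (suc zero))) = true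

goesWest goesNorth : Dir → Fin 4 → Bool
goesWest ccw q  = not (inSouthHalf q)
goesWest cw  q  = inSouthHalf q
goesNorth ccw q = inEastHalf q
goesNorth cw  q = not (inEastHalf q)

isCcw-flipDir : ∀ d → isCcw (flipDir d) ≡ not (isCcw d)
isCcw-flipDir ccw = refl
isCcw-flipDir cw  = refl

xor-not : ∀ a x → a xor not x ≡ not a xor x
xor-not a x = trans (sym (not-distribʳ-xor a x)) (not-distribˡ-xor a x)

quadrant : Bool → Bool → Fin 4
quadrant true  false = zero
quadrant false false = suc zero
quadrant false true  = suc (suc zero)
quadrant true  true  = suc (suc (suc zero))

quadrant-halves : ∀ east south →
                  inEastHalf (quadrant east south) ≡ east × inSouthHalf (quadrant east south) ≡ south
quadrant-halves true  false = refl , refl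
quadrant-halves false false = refl , refl
quadrant-halves false true  = refl , refl
quadrant-halves true  true  = refl , refl

-- Modulo 4 the positions of the two tracks of a quarter arc add up to twice
-- the colour of its circle; a finite check over the local configurations.
digits-colour : ∀ d pi pj q →
  (digit (goesWest d q xor pj) (goesWest d q xor inEastHalf q)
   + digit (not (goesNorth d q) xor pi) (not (goesNorth d q) xor inSouthHalf q)) % 4
  ≡ 2 * bit (isCcw d xor (pi xor pj)) % 4
digits-colour ccw false false zero = refl
digits-colour ccw false false (suc zero) = refl
digits-colour ccw false false (suc (suc zero)) = refl
digits-colour ccw false false (suc (suc (suc zero))) = refl
digits-colour ccw false true  zero = refl
digits-colour ccw false true  (suc zero) = refl
digits-colour ccw false true  (suc (suc zero)) = refl
digits-colour ccw false true  (suc (suc (suc zero))) = refl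
digits-colour ccw true  false zero = refl
digits-colour ccw true  false (suc zero) = refl
digits-colour ccw true  false (suc (suc zero)) = refl
digits-colour ccw true  false (suc (suc (suc zero))) = refl
digits-colour ccw true  true  zero = refl
digits-colour ccw true  true  (suc zero) = refl
digits-colour ccw true  true  (suc (suc zero)) = refl
digits-colour ccw true  true  (suc (suc (suc zero))) = refl
digits-colour cw  false false zero = refl
digits-colour cw  false false (suc zero) = refl
digits-colour cw  false false (suc (suc zero)) = refl
digits-colour cw  false false (suc (suc (suc zero))) = refl
digits-colour cw  false true  zero = refl
digits-colour cw  false true  (suc zero) = refl
digits-colour cw  false true  (suc (suc zero)) = refl
digits-colour cw  false true  (suc (suc (suc zero))) = refl
digits-colour cw  true  false zero = refl
digits-colour cw  true  false (suc zero) = refl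
digits-colour cw  true  false (suc (suc zero)) = refl
digits-colour cw  true  false (suc (suc (suc zero))) = refl
digits-colour cw  true  true  zero = refl
digits-colour cw  true  true  (suc zero) = refl
digits-colour cw  true  true  (suc (suc zero)) = refl
digits-colour cw  true  true  (suc (suc (suc zero))) = refl

module Rings {n′ m′ : ℕ} (g : DirAssignment (suc n′) (suc m′))
             (alternating : ∀ c c′ → Adjacent c c′ → g c ≢ g c′) where

  n m : ℕ
  n = suc n′
  m = suc m′

  Arc : Set
  Arc = State n m

  neighbour-flips : ∀ c c′ p → neighbour c p ≡ just c′ → g c′ ≡ flipDir (g c)
  neighbour-flips c c′ p e with g c in gc | g c′ in gc′
  ... | ccw | ccw = ⊥-elim (alternating c c′ (p , e) (trans gc (sym gc′)))
  ... | ccw | cw  = refl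
  ... | cw  | ccw = refl
  ... | cw  | cw  = ⊥-elim (alternating c c′ (p , e) (trans gc (sym gc′)))

  xTrack : Arc → Track m
  xTrack ((i , j) , q) = j , inEastHalf q , goesWest (g (i , j)) q

  yTrack : Arc → Track n
  yTrack ((i , j) , q) = i , inSouthHalf q , goesNorth (g (i , j)) q

  fromTracks : Track m → Track n → Arc
  fromTracks (j , east , _) (i , south , _) = (i , j) , quadrant east south

  coTrack : Arc → Track n
  coTrack s = reflect (yTrack s)

  tracks : Arc → Track m × Track n
  tracks s = xTrack s , coTrack s

  fromTracks-tracks : ∀ s → fromTracks (xTrack s) (coTrack s) ≡ s
  fromTracks-tracks (c , zero)                   = refl
  fromTracks-tracks (c , suc zero)               = refl
  fromTracks-tracks (c , suc (suc zero))         = refl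
  fromTracks-tracks (c , suc (suc (suc zero)))   = refl

  tracks-step : ∀ s → (xTrack (step g s) , yTrack (step g s)) ≡ (advance (xTrack s) , advance (yTrack s))
  tracks-step ((i , j) , q) with g (i , j) in gc
  tracks-step ((i , j) , zero) | ccw with up i in e
  ... | just i′ rewrite neighbour-flips (i , j) (i′ , j) north (cong (Maybe.map (_, j)) e) | gc = refl
  ... | nothing rewrite gc = refl
  tracks-step ((i , j) , suc zero) | ccw with up j in e
  ... | just j′ rewrite neighbour-flips (i , j) (i , j′) west (cong (Maybe.map (i ,_)) e) | gc = refl
  ... | nothing rewrite gc = refl
  tracks-step ((i , j) , suc (suc zero)) | ccw with down i in e
  ... | just i′ rewrite neighbour-flips (i , j) (i′ , j) south (cong (Maybe.map (_, j)) e) | gc = refl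
  ... | nothing rewrite gc = refl
  tracks-step ((i , j) , suc (suc (suc zero))) | ccw with down j in e
  ... | just j′ rewrite neighbour-flips (i , j) (i , j′) east (cong (Maybe.map (i ,_)) e) | gc = refl
  ... | nothing rewrite gc = refl
  tracks-step ((i , j) , zero) | cw with down j in e
  ... | just j′ rewrite neighbour-flips (i , j) (i , j′) east (cong (Maybe.map (i ,_)) e) | gc = refl
  ... | nothing rewrite gc = refl
  tracks-step ((i , j) , suc zero) | cw with up i in e
  ... | just i′ rewrite neighbour-flips (i , j) (i′ , j) north (cong (Maybe.map (_, j)) e) | gc = refl
  ... | nothing rewrite gc = refl
  tracks-step ((i , j) , suc (suc zero)) | cw with up j in e
  ... | just j′ rewrite neighbour-flips (i , j) (i , j′) west (cong (Maybe.map (i ,_)) e) | gc = refl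
  ... | nothing rewrite gc = refl
  tracks-step ((i , j) , suc (suc (suc zero))) | cw with down i in e
  ... | just i′ rewrite neighbour-flips (i , j) (i′ , j) south (cong (Maybe.map (_, j)) e) | gc = refl
  ... | nothing rewrite gc = refl

  -- Constant, since adjacent circles differ in direction and in the parity of
  -- one coordinate.
  colour : Circle n m → Bool
  colour (i , j) = isCcw (g (i , j)) xor (isOdd (toℕ i) xor isOdd (toℕ j))

  colour-west : ∀ i j → colour (i , suc j) ≡ colour (i , inject₁ j)
  colour-west i j = begin
    isCcw d xor (pi xor not pj)      ≡⟨ cong (isCcw d xor_) (not-distribʳ-xor pi pj) ⟨
    isCcw d xor not (pi xor pj)      ≡⟨ xor-not (isCcw d) (pi xor pj) ⟩
    not (isCcw d) xor (pi xor pj)    ≡⟨ cong₂ (λ a t → a xor (pi xor isOdd t)) flipped (toℕ-inject₁ j) ⟨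
    colour (i , inject₁ j)           ∎
    where
    open ≡-Reasoning
    d = g (i , suc j)
    pi = isOdd (toℕ i)
    pj = isOdd (toℕ j)
    flipped : isCcw (g (i , inject₁ j)) ≡ not (isCcw d)
    flipped = trans (cong isCcw (neighbour-flips (i , suc j) (i , inject₁ j) west refl)) (isCcw-flipDir d)

  colour-north : ∀ i j → colour (suc i , j) ≡ colour (inject₁ i , j)
  colour-north i j = begin
    isCcw d xor (not pi xor pj)      ≡⟨ cong (isCcw d xor_) (not-distribˡ-xor pi pj) ⟨
    isCcw d xor not (pi xor pj)      ≡⟨ xor-not (isCcw d) (pi xor pj) ⟩
    not (isCcw d) xor (pi xor pj)    ≡⟨ cong₂ (λ a t → a xor (isOdd t xor pj)) flipped (toℕ-inject₁ i) ⟨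
    colour (inject₁ i , j)           ∎
    where
    open ≡-Reasoning
    d = g (suc i , j)
    pi = isOdd (toℕ i)
    pj = isOdd (toℕ j)
    flipped : isCcw (g (inject₁ i , j)) ≡ not (isCcw d)
    flipped = trans (cong isCcw (neighbour-flips (suc i , j) (inject₁ i , j) north refl)) (isCcw-flipDir d)

  colour-constant : ∀ c → colour c ≡ colour (zero , zero)
  colour-constant (i , j) = trans (along-row j) (along-column i)
    where
    along-row : ∀ j → colour (i , j) ≡ colour (i , zero)
    along-row = <-weakInduction (λ j → colour (i , j) ≡ colour (i , zero)) refl
                  (λ j p → trans (colour-west i j) p)
    along-column : ∀ i → colour (i , zero) ≡ colour (zero , zero)
    along-column = <-weakInduction (λ i → colour (i , zero) ≡ colour (zero , zero)) refl
                     (λ i p → trans (colour-north i zero) p)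

  tracks-injective : ∀ s t → tracks s ≡ tracks t → s ≡ t
  tracks-injective s t e =
    trans (sym (fromTracks-tracks s)) (trans (cong (λ (a , b) → fromTracks a b) e) (fromTracks-tracks t))

  I : Bool
  I = colour (zero , zero)

  Admissible : Track m → Track n → Set
  Admissible a b = position a + position b ≡ 2 * bit I [mod 4 ]

  tracks-admissible : ∀ s → Admissible (xTrack s) (coTrack s)
  tracks-admissible s@((i , j) , q) = begin
    position (xTrack s) + position (coTrack s)
      ≈⟨ +-cong-≡[mod] (position-digit (xTrack s)) (position-digit (coTrack s)) ⟩
    digit (highBit (xTrack s)) (lowBit (xTrack s)) + digit (highBit (coTrack s)) (lowBit (coTrack s))
      ≈⟨ %-≡⇒≡[mod] (digits-colour (g (i , j)) (isOdd (toℕ i)) (isOdd (toℕ j)) q) ⟩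
    2 * bit (colour (i , j))
      ≡⟨ cong (λ b → 2 * bit b) (colour-constant (i , j)) ⟩
    2 * bit I ∎
    where open ≡[mod]-Reasoning 4

  private
    xTrack-fromTracks : ∀ a b → xTrack (fromTracks a b) ≡ a ⊎ xTrack (fromTracks a b) ≡ reflect a
    xTrack-fromTracks (j , east , e) (i , south , _) =
      subst (λ x → x ≡ (j , east , e) ⊎ x ≡ reflect (j , east , e))
        (cong (λ h → j , h , goesWest (g (i , j)) (quadrant east south)) (sym (proj₁ (quadrant-halves east south))))
        (reflect-or-same j east e _)

    coTrack-fromTracks : ∀ a b → coTrack (fromTracks a b) ≡ b ⊎ coTrack (fromTracks a b) ≡ reflect b
    coTrack-fromTracks (j , east , _) (i , south , e) =
      subst (λ y → y ≡ (i , south , e) ⊎ y ≡ reflect (i , south , e))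
        (cong (λ h → i , h , not (goesNorth (g (i , j)) (quadrant east south))) (sym (proj₂ (quadrant-halves east south))))
        (reflect-or-same i south e _)

  tracks-fromTracks : ∀ a b → Admissible a b → tracks (fromTracks a b) ≡ (a , b)
  tracks-fromTracks a b adm = uncurry (cong₂ _,_) (same-parity⇒unreflected {c = bit I} adm
    (tracks-admissible (fromTracks a b)) (xTrack-fromTracks a b) (coTrack-fromTracks a b))

  diagonal : Arc → ℕ
  diagonal s = position (xTrack s) + position (coTrack s)

  -- Since the diagonal is 2 I modulo 4, the level determines it.
  level : Arc → ℕ
  level s = diagonal s / 4

  diagonal-%4 : ∀ s t → diagonal s % 4 ≡ diagonal t % 4
  diagonal-%4 s t = ≡[mod]⇒%-≡ (≡[mod]-trans (tracks-admissible s) (≡[mod]-sym (tracks-admissible t)))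

  gg : ℕ
  gg = gcd n m

  instance
    gg-nonZero : NonZero gg
    gg-nonZero = ≢-nonZero (gcd[m,n]≢0 n m (inj₁ λ ()))

  mod-x⇒mod-gg : ∀ {a b} → a ≡ b [mod 4 * m ] → a ≡ b [mod 4 * gg ]
  mod-x⇒mod-gg = ∣-≡[mod] (*-monoʳ-∣ 4 (gcd[m,n]∣n n m))

  mod-y⇒mod-gg : ∀ {a b} → a ≡ b [mod 4 * n ] → a ≡ b [mod 4 * gg ]
  mod-y⇒mod-gg = ∣-≡[mod] (*-monoʳ-∣ 4 (gcd[m,n]∣m n m))

  xPosition-step : ∀ s → position (xTrack (step g s)) ≡ 1 + position (xTrack s) [mod 4 * m ]
  xPosition-step s = subst (λ a → position a ≡ 1 + position (xTrack s) [mod 4 * m ])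
    (sym (cong proj₁ (tracks-step s))) (position-advance (xTrack s))

  yPosition-step : ∀ s → position (yTrack (step g s)) ≡ 1 + position (yTrack s) [mod 4 * n ]
  yPosition-step s = subst (λ a → position a ≡ 1 + position (yTrack s) [mod 4 * n ])
    (sym (cong proj₂ (tracks-step s))) (position-advance (yTrack s))

  diagonal-step : ∀ s → diagonal (step g s) ≡ diagonal s [mod 4 * gg ]
  diagonal-step s = +-cancelʳ-≡[mod] 1 (begin
    X′ + Y′ + 1          ≡⟨ +-assoc X′ Y′ 1 ⟩
    X′ + (Y′ + 1)        ≈⟨ +-cong-≡[mod] (≡[mod]-refl {a = X′}) (mod-y⇒mod-gg (position-reflect-≡[mod] {a = yTrack s} {b = yTrack (step g s)} (yPosition-step s))) ⟩
    X′ + Y               ≈⟨ +-cong-≡[mod] (mod-x⇒mod-gg (xPosition-step s)) (≡[mod]-refl {a = Y}) ⟩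
    1 + X + Y            ≡⟨ +-comm 1 (X + Y) ⟩
    X + Y + 1            ∎)
    where
    open ≡[mod]-Reasoning (4 * gg)
    X = position (xTrack s)
    Y = position (coTrack s)
    X′ = position (xTrack (step g s))
    Y′ = position (coTrack (step g s))

  level-≡[mod] : ∀ s t {u v} → diagonal s + 4 * u ≡ diagonal t + 4 * v [mod 4 * gg ] →
                 level s + u ≡ level t + v [mod gg ]
  level-≡[mod] s t {u} {v} = /-≡[mod] 4 {gg} {diagonal s} {diagonal t} {u} {v} (diagonal-%4 s t)

  level-step : ∀ s → level (step g s) ≡ level s [mod gg ]
  level-step s = subst₂ _≡_[mod gg ] (+-identityʳ _) (+-identityʳ _)
    (level-≡[mod] (step g s) s {0} {0} (+-cong-≡[mod] (diagonal-step s) ≡[mod]-refl))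

  diagonal-≡[mod] : ∀ s t → level s ≡ level t [mod gg ] → diagonal s ≡ diagonal t [mod 4 * gg ]
  diagonal-≡[mod] s t level≡ = begin
    diagonal s                     ≡⟨ m≡m%n+[m/n]*n (diagonal s) 4 ⟩
    diagonal s % 4 + level s * 4   ≡⟨ cong₂ _+_ (diagonal-%4 s t) (*-comm (level s) 4) ⟩
    diagonal t % 4 + 4 * level s   ≈⟨ +-cong-≡[mod] (≡[mod]-refl {a = diagonal t % 4}) (*-cong-≡[mod] 4 level≡) ⟩
    diagonal t % 4 + 4 * level t   ≡⟨ cong (diagonal t % 4 +_) (*-comm 4 (level t)) ⟩
    diagonal t % 4 + level t * 4   ≡⟨ m≡m%n+[m/n]*n (diagonal t) 4 ⟨
    diagonal t                     ∎
    where open ≡[mod]-Reasoning (4 * gg)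

  ring : Arc → Fin gg
  ring s = level s mod gg

  level-ring : ∀ s → level s ≡ toℕ (ring s) [mod gg ]
  level-ring s = mod-≡⇒≡[mod] refl

  ring-≡⇒level-≡ : ∀ s t → ring s ≡ ring t → level s ≡ level t [mod gg ]
  ring-≡⇒level-≡ s t e =
    ≡[mod]-trans (level-ring s) (subst (λ r → toℕ r ≡ level t [mod gg ]) (sym e) (≡[mod]-sym (level-ring t)))

  level-≡⇒ring-≡ : ∀ s t → level s ≡ level t [mod gg ] → ring s ≡ ring t
  level-≡⇒ring-≡ s t level≡ = ≡[mod]⇒mod-≡ (≡[mod]-trans level≡ (level-ring t))

  ring-step : ∀ s → ring (step g s) ≡ ring s
  ring-step s = level-≡⇒ring-≡ (step g s) s (level-step s)

  xPosition-iter : ∀ k s → position (xTrack (iter k (step g) s)) ≡ k + position (xTrack s) [mod 4 * m ]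
  xPosition-iter k s = subst (λ x → position (xTrack (iter k (step g) s)) ≡ x + position (xTrack s) [mod 4 * m ])
    (*-identityʳ k) (iter-≡[mod] {f = step g} (position ∘ xTrack) xPosition-step k s)

  yPosition-iter : ∀ k s → position (yTrack (iter k (step g) s)) ≡ k + position (yTrack s) [mod 4 * n ]
  yPosition-iter k s = subst (λ x → position (yTrack (iter k (step g) s)) ≡ x + position (yTrack s) [mod 4 * n ])
    (*-identityʳ k) (iter-≡[mod] {f = step g} (position ∘ yTrack) yPosition-step k s)

  bézout : Bézout.Identity (4 * gg) (4 * m) (4 * n)
  bézout = Bézout.identity (subst (GCD (4 * m) (4 * n))
    (trans (sym (c*gcd[m,n]≡gcd[cm,cn] 4 m n)) (cong (4 *_) (gcd-comm m n))) (gcd-GCD (4 * m) (4 * n)))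

  -- By the Chinese remainder theorem some iterate of the step has both
  -- track positions of the target, since gcd (4 m) (4 n) = 4 gg.
  reach : ∀ s t → level s ≡ level t [mod gg ] → SameRing g s t
  reach s t level≡ = from-crt (crt bézout (diagonal-≡[mod] s t level≡))
    where
    from-crt : ∃[ k ] (position (xTrack s) + k ≡ position (xTrack t) [mod 4 * m ])
                    × (position (coTrack t) + k ≡ position (coTrack s) [mod 4 * n ]) →
               SameRing g s t
    from-crt (k , x≡ , y≡) = k , tracks-injective u t
      (cong₂ _,_ (position-injective _ _ xPosition≡) (position-injective _ _ coPosition≡))
      where
      u = iter k (step g) s
      xPosition≡ : position (xTrack u) ≡ position (xTrack t)
      xPosition≡ = ≡[mod]⇒≡ (position-< (xTrack u)) (position-< (xTrack t))
        (≡[mod]-trans (xPosition-iter k s) (subst (_≡ position (xTrack t) [mod 4 * m ]) (+-comm _ k) x≡))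
      coPosition≡ : position (coTrack u) ≡ position (coTrack t)
      coPosition≡ = ≡[mod]⇒≡ (position-< (coTrack u)) (position-< (coTrack t))
        (+-cancelʳ-≡[mod] k (≡[mod]-trans (position-reflect-≡[mod] {a = yTrack s} {b = yTrack u} (yPosition-iter k s))
          (≡[mod]-sym y≡)))

  ring-≡⇔SameRing : ∀ s t → (ring s ≡ ring t) ⇔ SameRing g s t
  ring-≡⇔SameRing s t = mk⇔ (reach s t ∘ ring-≡⇒level-≡ s t)
    (λ (k , e) → trans (sym (iter-invariant {f = step g} ring ring-step k s)) (cong ring e))

  shiftX shiftY : Arc → Arc
  shiftX s = fromTracks (jump (xTrack s)) (coTrack s)
  shiftY s = fromTracks (xTrack s) (jump (coTrack s))

  tracks-shiftX : ∀ s → tracks (shiftX s) ≡ (jump (xTrack s) , coTrack s)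
  tracks-shiftX s = tracks-fromTracks _ _
    (≡[mod]-trans (+-cong-≡[mod] (position-jump-≡[mod4] (xTrack s)) ≡[mod]-refl) (tracks-admissible s))

  tracks-shiftY : ∀ s → tracks (shiftY s) ≡ (xTrack s , jump (coTrack s))
  tracks-shiftY s = tracks-fromTracks _ _
    (≡[mod]-trans (+-cong-≡[mod] (≡[mod]-refl {a = position (xTrack s)}) (position-jump-≡[mod4] (coTrack s)))
      (tracks-admissible s))

  shiftX-period : ∀ s → iter m shiftX s ≡ s
  shiftX-period s = tracks-injective _ s (trans (tracks-iter m s) (cong (_, coTrack s) (jump-period (xTrack s))))
    where
    tracks-iter : ∀ k s → tracks (iter k shiftX s) ≡ (iter k jump (xTrack s) , coTrack s)
    tracks-iter zero    s = refl
    tracks-iter (suc k) s = trans (tracks-shiftX (iter k shiftX s))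
      (cong (λ (a , b) → jump a , b) (tracks-iter k s))

  shiftY-period : ∀ s → iter n shiftY s ≡ s
  shiftY-period s = tracks-injective _ s (trans (tracks-iter n s) (cong (xTrack s ,_) (jump-period (coTrack s))))
    where
    tracks-iter : ∀ k s → tracks (iter k shiftY s) ≡ (xTrack s , iter k jump (coTrack s))
    tracks-iter zero    s = refl
    tracks-iter (suc k) s = trans (tracks-shiftY (iter k shiftY s))
      (cong (λ (a , b) → a , jump b) (tracks-iter k s))

  level-suc : ∀ s t → diagonal t ≡ 4 + diagonal s [mod 4 * gg ] → level t ≡ 1 + level s [mod gg ]
  level-suc s t t≡4+s = subst₂ _≡_[mod gg ] (+-identityʳ (level t)) (+-comm (level s) 1)
    (level-≡[mod] t s {0} {1} (subst₂ _≡_[mod 4 * gg ] (sym (+-identityʳ (diagonal t))) (+-comm 4 (diagonal s)) t≡4+s))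

  level-shiftX : ∀ s → level (shiftX s) ≡ 1 + level s [mod gg ]
  level-shiftX s = level-suc s (shiftX s) (begin
    diagonal (shiftX s)          ≡⟨ cong (λ (a , b) → position a + position b) (tracks-shiftX s) ⟩
    position (jump X) + position Y ≈⟨ +-cong-≡[mod] (mod-x⇒mod-gg (position-jump X)) (≡[mod]-refl {a = position Y}) ⟩
    4 + position X + position Y  ≡⟨ +-assoc 4 (position X) (position Y) ⟩
    4 + diagonal s               ∎)
    where
    open ≡[mod]-Reasoning (4 * gg)
    X = xTrack s
    Y = coTrack s

  level-shiftY : ∀ s → level (shiftY s) ≡ 1 + level s [mod gg ]
  level-shiftY s = level-suc s (shiftY s) (begin
    diagonal (shiftY s)            ≡⟨ cong (λ (a , b) → position a + position b) (tracks-shiftY s) ⟩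
    position X + position (jump Y) ≈⟨ +-cong-≡[mod] (≡[mod]-refl {a = position X}) (mod-y⇒mod-gg (position-jump Y)) ⟩
    position X + (4 + position Y)  ≡⟨ +-comm-4 (position X) (position Y) ⟩
    4 + diagonal s                 ∎)
    where
    open ≡[mod]-Reasoning (4 * gg)
    X = xTrack s
    Y = coTrack s
    +-comm-4 : ∀ x y → x + (4 + y) ≡ 4 + (x + y)
    +-comm-4 = solve-∀

  level-iter : ∀ {τ : Arc → Arc} → (∀ s → level (τ s) ≡ 1 + level s [mod gg ]) →
               ∀ k s → level (iter k τ s) ≡ level s + k [mod gg ]
  level-iter {τ} level-τ k s = subst (level (iter k τ s) ≡_[mod gg ])
    (trans (cong (_+ level s) (*-identityʳ k)) (+-comm k (level s))) (iter-≡[mod] {f = τ} level level-τ k s)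

  ring-surjective : ∀ r → ∃[ s ] ring s ≡ r
  ring-surjective r = reach-r (≡[mod]-solvable (level s₀) (toℕ r))
    where
    s₀ : Arc
    s₀ = (zero , zero) , zero
    reach-r : ∃[ k ] level s₀ + k ≡ toℕ r [mod gg ] → ∃[ s ] ring s ≡ r
    reach-r (k , s₀+k≡r) = iter k shiftX s₀ , ≡[mod]⇒mod-≡ (≡[mod]-trans (level-iter level-shiftX k s₀) s₀+k≡r)

  count : (Arc → ℕ) → Fin gg → ℕ
  count h r = sumState n m (λ s → h s * ind (ring s ≟ᶠ r))

  -- The k-th power of the shift maps ring r onto ring r + k.
  count-shift-invariant : ∀ (τ : Arc → Arc) p → (∀ s → τ (iter p τ s) ≡ s) →
                          (∀ s → level (τ s) ≡ 1 + level s [mod gg ]) →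
                          ∀ h → (∀ s → h (τ s) ≡ h s) → ∀ r r′ → count h r ≡ count h r′
  count-shift-invariant τ p period level-τ h h-τ r r′ = by-offset (≡[mod]-solvable (toℕ r) (toℕ r′))
    where
    by-offset : ∃[ k ] toℕ r + k ≡ toℕ r′ [mod gg ] → count h r ≡ count h r′
    by-offset (k , r+k≡r′) = sym (begin
      count h r′                                              ≡⟨ sumState-reindex (λ s → h s * ind (ring s ≟ᶠ r′)) σ σ⁻¹ σσ⁻¹ σ⁻¹σ ⟨
      sumState n m (λ s → h (σ s) * ind (ring (σ s) ≟ᶠ r′))    ≡⟨ sumState-cong pointwise ⟩
      count h r                                               ∎)
      where
      open ≡-Reasoning
      σ σ⁻¹ : Arc → Arc
      σ = iter k τ
      σ⁻¹ = iter k (iter p τ)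
      σσ⁻¹ : ∀ s → σ (σ⁻¹ s) ≡ s
      σσ⁻¹ = iter-inverse period k
      σ⁻¹σ : ∀ s → σ⁻¹ (σ s) ≡ s
      σ⁻¹σ = iter-inverse (λ s → trans (sym (iter-commute τ (λ _ → refl) p s)) (period s)) k
      σ-ring : ∀ s → ring (σ s) ≡ r′ → ring s ≡ r
      σ-ring s e = ≡[mod]⇒mod-≡ (+-cancelʳ-≡[mod] k (≡[mod]-trans (≡[mod]-sym (level-iter level-τ k s))
        (≡[mod]-trans (mod-≡⇒≡[mod] e) (≡[mod]-sym r+k≡r′))))
      ring-σ : ∀ s → ring s ≡ r → ring (σ s) ≡ r′
      ring-σ s e = ≡[mod]⇒mod-≡ (≡[mod]-trans (level-iter level-τ k s)
        (≡[mod]-trans (+-cong-≡[mod] (mod-≡⇒≡[mod] e) (≡[mod]-refl {a = k})) r+k≡r′))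
      pointwise : ∀ s → h (σ s) * ind (ring (σ s) ≟ᶠ r′) ≡ h s * ind (ring s ≟ᶠ r)
      pointwise s = cong₂ _*_ (iter-invariant h h-τ k s)
        (ind-cong (ring (σ s) ≟ᶠ r′) (ring s ≟ᶠ r) (σ-ring s) (ring-σ s))

  wallTrackHit : Wall → Arc → ℕ
  wallTrackHit top    s = lowEndHit (yTrack s)
  wallTrackHit bottom s = highEndHit (yTrack s)
  wallTrackHit left   s = lowEndHit (xTrack s)
  wallTrackHit right  s = highEndHit (xTrack s)

  private
    pick₀ : ∀ W a b c d → W * a ≡ W * 1 * a + (W * 0 * b + (W * 0 * c + (W * 0 * d + 0)))
    pick₀ = solve-∀
    pick₁ : ∀ W a b c d → W * b ≡ W * 0 * a + (W * 1 * b + (W * 0 * c + (W * 0 * d + 0)))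
    pick₁ = solve-∀
    pick₂ : ∀ W a b c d → W * c ≡ W * 0 * a + (W * 0 * b + (W * 1 * c + (W * 0 * d + 0)))
    pick₂ = solve-∀
    pick₃ : ∀ W a b c d → W * d ≡ W * 0 * a + (W * 0 * b + (W * 0 * c + (W * 1 * d + 0)))
    pick₃ = solve-∀

  -- On each circle exactly the quarter arc arriving at the wall point has a
  -- track reaching the corresponding end.
  wallHit-local : ∀ w c (R : Fin 4 → ℕ) →
                  ind (onWall? w c) * R (arcInto (g c) (wallPoint w)) ≡ sumFin 4 (λ q → wallTrackHit w (c , q) * R q)
  wallHit-local top (i , j) R with g (i , j)
  ... | ccw = pick₀ (ind (toℕ i ≟ 0)) _ _ _ _
  ... | cw  = pick₁ (ind (toℕ i ≟ 0)) _ _ _ _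
  wallHit-local bottom (i , j) R with g (i , j)
  ... | ccw = pick₂ (ind (suc (toℕ i) ≟ n)) _ _ _ _
  ... | cw  = pick₃ (ind (suc (toℕ i) ≟ n)) _ _ _ _
  wallHit-local left (i , j) R with g (i , j)
  ... | ccw = pick₁ (ind (toℕ j ≟ 0)) _ _ _ _
  ... | cw  = pick₂ (ind (toℕ j ≟ 0)) _ _ _ _
  wallHit-local right (i , j) R with g (i , j)
  ... | ccw = pick₃ (ind (suc (toℕ j) ≟ m)) _ _ _ _
  ... | cw  = pick₀ (ind (suc (toℕ j) ≟ m)) _ _ _ _

  wallHits-count : ∀ w r → wallHits g ring w r ≡ count (wallTrackHit w) r
  wallHits-count w r =
    sumFin-cong n (λ i → sumFin-cong m (λ j → wallHit-local w (i , j) (λ q → ind (ring ((i , j) , q) ≟ᶠ r))))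

  yTrack-shiftX : ∀ s → yTrack (shiftX s) ≡ yTrack s
  yTrack-shiftX s = begin
    yTrack (shiftX s)                     ≡⟨ reflect-involutive (yTrack (shiftX s)) ⟨
    reflect (coTrack (shiftX s))          ≡⟨ cong (reflect ∘ proj₂) (tracks-shiftX s) ⟩
    reflect (coTrack s)                   ≡⟨ reflect-involutive (yTrack s) ⟩
    yTrack s                              ∎
    where open ≡-Reasoning

  xTrack-shiftY : ∀ s → xTrack (shiftY s) ≡ xTrack s
  xTrack-shiftY s = cong proj₁ (tracks-shiftY s)

  count-shiftX-invariant : ∀ h → (∀ s → h (shiftX s) ≡ h s) → ∀ r r′ → count h r ≡ count h r′
  count-shiftX-invariant = count-shift-invariant shiftX m′ shiftX-period level-shiftX

  count-shiftY-invariant : ∀ h → (∀ s → h (shiftY s) ≡ h s) → ∀ r r′ → count h r ≡ count h r′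
  count-shiftY-invariant = count-shift-invariant shiftY n′ shiftY-period level-shiftY

  ringLength-count : ∀ r → ringLength ring r ≡ count (λ _ → 1) r
  ringLength-count r = sumState-cong (λ s → sym (*-identityˡ (ind (ring s ≟ᶠ r))))

  ringLength-equal : ∀ r r′ → ringLength ring r ≡ ringLength ring r′
  ringLength-equal r r′ = begin
    ringLength ring r      ≡⟨ ringLength-count r ⟩
    count (λ _ → 1) r      ≡⟨ count-shiftX-invariant (λ _ → 1) (λ _ → refl) r r′ ⟩
    count (λ _ → 1) r′     ≡⟨ ringLength-count r′ ⟨
    ringLength ring r′     ∎
    where open ≡-Reasoning

  wallHits-equal : ∀ w r r′ → wallHits g ring w r ≡ wallHits g ring w r′
  wallHits-equal w r r′ = trans (wallHits-count w r) (trans (invariant w) (sym (wallHits-count w r′)))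
    where
    invariant : ∀ w → count (wallTrackHit w) r ≡ count (wallTrackHit w) r′
    invariant top    = count-shiftX-invariant _ (cong lowEndHit ∘ yTrack-shiftX) r r′
    invariant bottom = count-shiftX-invariant _ (cong highEndHit ∘ yTrack-shiftX) r r′
    invariant left   = count-shiftY-invariant _ (cong lowEndHit ∘ xTrack-shiftY) r r′
    invariant right  = count-shiftY-invariant _ (cong highEndHit ∘ xTrack-shiftY) r r′


mainTheorem2 : (n m : ℕ) → 1 ≤ n → 1 ≤ m → (g : DirAssignment n m) →
    (∀ c c' → Adjacent c c' → g c ≢ g c') →
    ∃[ ρ ] ((∀ s t → (ρ s ≡ ρ t) ⇔ SameRing g s t)
      × (∀ (r : Fin (gcd n m)) → ∃[ s ] ρ s ≡ r)
      × (∀ r r' → ringLength ρ r ≡ ringLength ρ r')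
      × (∀ w r r' → wallHits g ρ w r ≡ wallHits g ρ w r'))
mainTheorem2 (suc n′) (suc m′) (s≤s _) (s≤s _) g alternating =
  ring , ring-≡⇔SameRing , ring-surjective , ringLength-equal , wallHits-equal
  where
  open Rings g alternating
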